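{- Let $y=y_1\cdots y_n\in S_n$ and let $y_iy_jy_ky_ly_m$ ($i<j<k<l<m$) be an occurrence of the pattern $3$-$5$-$1$-$4$-$2$ in $y$, i.e. $y_k<y_m<y_i<y_l<y_j$. If every entry $y_p$ with $y_m<y_p<y_l$ occurs before $y_j$ in $y$ (i.e. $p<j$), then $y$ contains an occurrence of the pattern $3$-$51$-$4$-$2$.
   Context: An occurrence of the dashed pattern $3$-$51$-$4$-$2$ in $y$ is a subsequence $y_{a}y_{b}y_{b+1}y_{c}y_{d}$ with $a<b<b+1<c<d$ (the entries playing the roles of $5$ and $1$ in adjacent positions) and $y_{b+1}<y_d<y_a<y_c<y_b$. -}

module Defs where

open import Data.Nat using (ℕ; suc)
open import Data.Fin using (Fin; toℕ; _<_)
open import Data.Fin.Permutation using (Permutation′; _⟨$⟩ʳ_)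
open import Data.Product using (∃-syntax; _×_)

-- A permutation y ∈ S_n is a bijection Fin n → Fin n; y_p is  y ⟨$⟩ʳ p.
-- Positions and values are both in Fin n (0-indexed), ordered by Fin's _<_.

Occ35142 : {n : ℕ} → Permutation′ n → Fin n → Fin n → Fin n → Fin n → Fin n → Set
Occ35142 y i j k l m =
  (i < j) × (j < k) × (k < l) × (l < m) ×
  ((y ⟨$⟩ʳ k) < (y ⟨$⟩ʳ m)) × ((y ⟨$⟩ʳ m) < (y ⟨$⟩ʳ i)) ×
  ((y ⟨$⟩ʳ i) < (y ⟨$⟩ʳ l)) × ((y ⟨$⟩ʳ l) < (y ⟨$⟩ʳ j))

-- Occurrence of the dashed pattern 3-51-4-2: y_a y_b y_{b+1} y_c y_d with
-- a < b < b+1 < c < d and y_{b+1} < y_d < y_a < y_c < y_b.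
-- The adjacency is expressed as toℕ b' ≡ suc (toℕ b).
open import Relation.Binary.PropositionalEquality using (_≡_)

Occ3-51-4-2 : {n : ℕ} → Permutation′ n → Fin n → Fin n → Fin n → Fin n → Fin n → Set
Occ3-51-4-2 y a b b' c d =
  (a < b) × (toℕ b' ≡ suc (toℕ b)) × (b' < c) × (c < d) ×
  ((y ⟨$⟩ʳ b') < (y ⟨$⟩ʳ d)) × ((y ⟨$⟩ʳ d) < (y ⟨$⟩ʳ a)) ×
  ((y ⟨$⟩ʳ a) < (y ⟨$⟩ʳ c)) × ((y ⟨$⟩ʳ c) < (y ⟨$⟩ʳ b))

Contains3-51-4-2 : {n : ℕ} → Permutation′ n → Set
Contains3-51-4-2 {n} y =
  ∃[ a ] ∃[ b ] ∃[ b' ] ∃[ c ] ∃[ d ] Occ3-51-4-2 {n} y a b b' c d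

module Submission where

-- Let y_i y_j y_k y_l y_m be an occurrence of 3-5-1-4-2.
-- Reading y from position j (where y_j > y_l) to position k (where
-- y_k < y_l), the property "value above y_l" must be lost at some step:
-- there is an adjacent pair b, b+1 with j ≤ b < b+1 ≤ k, y_b > y_l and
-- y_{b+1} ≯ y_l.  Since b+1 < l, y_{b+1} ≠ y_l, so y_{b+1} < y_l; since
-- b+1 > j, the hypothesis forbids y_m < y_{b+1} < y_l, and b+1 < m gives
-- y_{b+1} ≠ y_m, hence y_{b+1} < y_m.  Then y_i y_b y_{b+1} y_l y_m is an
-- occurrence of 3-51-4-2.

open import Defs
open import Data.Nat using (ℕ; zero; suc; z≤n; s≤s)
import Data.Nat as ℕ
import Data.Nat.Properties as ℕP
open import Data.Fin using (Fin; toℕ; fromℕ<; _<_; _≤_; _<?_)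
import Data.Fin.Properties as FinP
open import Data.Fin.Permutation using (Permutation′; _⟨$⟩ʳ_; _⟨$⟩ˡ_; inverseˡ)
open import Data.Product using (∃-syntax; _×_; _,_)
open import Data.Sum using (inj₁; inj₂)
open import Relation.Nullary using (¬_; yes; no; contradiction)
open import Relation.Unary using (Pred; Decidable)
open import Relation.Binary.PropositionalEquality
  using (_≡_; _≢_; refl; sym; trans; cong; subst)

crossingℕ : ∀ {p} (P : Pred ℕ p) → Decidable P →
            ∀ {j k} → j ℕ.≤ k → P j → ¬ P k →
            ∃[ b ] (j ℕ.≤ b × b ℕ.< k × P b × ¬ P (suc b))
crossingℕ P P? {k = zero}  z≤n Pj ¬Pk = contradiction Pj ¬Pk
crossingℕ P P? {j} {suc k} j≤1+k Pj ¬P1+k with ℕP.m≤n⇒m<n∨m≡n j≤1+k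
... | inj₂ refl = contradiction Pj ¬P1+k
... | inj₁ (s≤s j≤k) with P? k
...   | yes Pk = k , j≤k , ℕP.n<1+n k , Pk , ¬P1+k
...   | no ¬Pk with crossingℕ P P? j≤k Pj ¬Pk
...     | b , j≤b , b<k , Pb , ¬P1+b = b , j≤b , ℕP.m<n⇒m<1+n b<k , Pb , ¬P1+b

onℕ : ∀ {n p} → Pred (Fin n) p → Pred ℕ p
onℕ {n} P x = (x<n : x ℕ.< n) → P (fromℕ< x<n)

onℕ? : ∀ {n p} {P : Pred (Fin n) p} → Decidable P → Decidable (onℕ P)
onℕ? {n} P? x with x ℕ.<? n
... | no x≮n = yes (λ x<n → contradiction x<n x≮n)
... | yes x<n with P? (fromℕ< x<n)
...   | yes Px = yes (λ _ → Px)
...   | no ¬Px = no (λ Px → ¬Px (Px x<n))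

crossingFin : ∀ {n p} (P : Pred (Fin n) p) → Decidable P →
              ∀ {j k} → j ≤ k → P j → ¬ P k →
              ∃[ b ] ∃[ b' ] (toℕ b' ≡ suc (toℕ b) × j ≤ b × b' ≤ k × P b × ¬ P b')
crossingFin {n} P P? {j} {k} j≤k Pj ¬Pk
  with crossingℕ (onℕ P) (onℕ? P?) j≤k
         (λ j<n → subst P (sym (FinP.fromℕ<-toℕ j j<n)) Pj)
         (λ Pk → ¬Pk (subst P (FinP.fromℕ<-toℕ k (FinP.toℕ<n k)) (Pk (FinP.toℕ<n k))))
... | b , j≤b , b<k , Pb , ¬P1+b =
  fromℕ< b<n , fromℕ< 1+b<n ,
  trans (FinP.toℕ-fromℕ< 1+b<n) (cong suc (sym (FinP.toℕ-fromℕ< b<n))) ,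
  subst (toℕ j ℕ.≤_) (sym (FinP.toℕ-fromℕ< b<n)) j≤b ,
  subst (ℕ._≤ toℕ k) (sym (FinP.toℕ-fromℕ< 1+b<n)) b<k ,
  Pb b<n ,
  λ P1+b → ¬P1+b (λ _ → P1+b)
  where
  1+b<n : suc b ℕ.< n
  1+b<n = ℕP.≤-<-trans b<k (FinP.toℕ<n k)

  b<n : b ℕ.< n
  b<n = ℕP.<-trans (ℕP.n<1+n b) 1+b<n

permutation-injective : ∀ {n} (y : Permutation′ n) {p q : Fin n} →
                        p ≢ q → y ⟨$⟩ʳ p ≢ y ⟨$⟩ʳ q
permutation-injective y p≢q yp≡yq =
  p≢q (trans (sym (inverseˡ y)) (trans (cong (y ⟨$⟩ˡ_) yp≡yq) (inverseˡ y)))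

below : ∀ {n} {u v : Fin n} → ¬ v < u → u ≢ v → u < v
below v≮u u≢v = FinP.≤∧≢⇒< (ℕP.≮⇒≥ v≮u) u≢v

proposition4p7 : (n : ℕ) (y : Permutation′ n) (i j k l m : Fin n) →
    Occ35142 y i j k l m →
    ((p : Fin n) → (y ⟨$⟩ʳ m) < (y ⟨$⟩ʳ p) → (y ⟨$⟩ʳ p) < (y ⟨$⟩ʳ l) → p < j) →
    Contains3-51-4-2 y
proposition4p7 n y i j k l m (i<j , j<k , k<l , l<m , yk<ym , ym<yi , yi<yl , yl<yj) between
  with crossingFin (λ p → y ⟨$⟩ʳ l < y ⟨$⟩ʳ p) (λ p → y ⟨$⟩ʳ l <? y ⟨$⟩ʳ p)
                   (ℕP.<⇒≤ j<k) yl<yj yl≮yk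
  where
  yl≮yk : ¬ y ⟨$⟩ʳ l < y ⟨$⟩ʳ k
  yl≮yk = ℕP.<-asym (ℕP.<-trans yk<ym (ℕP.<-trans ym<yi yi<yl))
... | b , b' , b'≡1+b , j≤b , b'≤k , yl<yb , yl≮yb' =
  i , b , b' , l , m ,
  ℕP.<-≤-trans i<j j≤b , b'≡1+b , b'<l , l<m , yb'<ym , ym<yi , yi<yl , yl<yb
  where
  b'<l : b' < l
  b'<l = ℕP.≤-<-trans b'≤k k<l

  j<b' : j < b'
  j<b' = subst (toℕ j ℕ.<_) (sym b'≡1+b) (s≤s j≤b)

  yb'<yl : y ⟨$⟩ʳ b' < y ⟨$⟩ʳ l
  yb'<yl = below yl≮yb' (permutation-injective y (FinP.<⇒≢ b'<l))

  -- b' lies after j, so by hypothesis y_{b'} is not strictly between y_m and y_l.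
  yb'<ym : y ⟨$⟩ʳ b' < y ⟨$⟩ʳ m
  yb'<ym = below (λ ym<yb' → ℕP.<-asym j<b' (between b' ym<yb' yb'<yl))
                 (permutation-injective y (FinP.<⇒≢ (ℕP.<-trans b'<l l<m)))
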